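{- Let $A=(a_{ij})$ be an $n\times n$ $(0,1)$-matrix representing a binary relation $\rho$ on $\{1,\dots,n\}$. Algorithm 1 (described in the context), run on $A$, terminates in time $O(n^3)$, and its output $T$ is a maximal transitive relation contained in $\rho$.
   Context: A binary relation $\rho$ on $S=\{1,\dots,n\}$ is a subset of $S\times S$; it is represented by the $n\times n$ $(0,1)$-matrix $A=(a_{ij})$ with $a_{ij}=1$ iff $(i,j)\in\rho$ (equivalently, by the digraph on $S$ with an arc $(i,j)$ iff $a_{ij}=1$). A relation $\rho'$ is contained in $\rho$ if $\rho'\subseteq\rho$. A relation $\alpha$ is transitive if $(a,b),(b,c)\in\alpha$ implies $(a,c)\in\alpha$. A transitive relation $\alpha$ contained in $\rho$ is a maximal transitive relation contained in $\rho$ if there is no transitive relation $\beta$ with $\alpha\subsetneq\beta\subseteq\rho$. Algorithm 1 modifies the matrix $A$ in place and then returns it as $T$: for $i=1,2,\dots,n$ (in increasing order), for $j=1,2,\dots,n$ with $j\neq i$ (in increasing order), if currently $a_{ij}=1$, then for $k=1,2,\dots,n$: (a) if $k\neq j$ and currently $a_{ik}=0$, set $a_{jk}:=0$; (b) if $k\neq i$ and currently $a_{kj}=0$, set $a_{ki}:=0$. Each matrix entry read or write costs $O(1)$ time. -}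

module Defs where

open import Data.Nat using (ℕ; suc; _+_)
open import Data.Bool using (Bool; true; false; if_then_else_; _∧_)
open import Data.Fin using (Fin; _≟_)
open import Data.List using (List; foldl; allFin)
open import Relation.Nullary.Decidable using (⌊_⌋)
open import Relation.Binary.PropositionalEquality using (_≡_)

-- An n×n (0,1)-matrix; true = 1, false = 0.  Indices 1..n are Fin n = 0..n-1.
Matrix : ℕ → Set
Matrix n = Fin n → Fin n → Bool

Rel⟦_⟧ : ∀ {n} → Matrix n → Fin n → Fin n → Set
Rel⟦ A ⟧ i j = A i j ≡ true

-- Machine state: current matrix plus a step counter.  Every matrix entry
-- read or write costs one unit; every iteration of a loop body also costs one unit.
record State (n : ℕ) : Set where
  constructor ⟨_,_⟩
  field
    mat  : Matrix n
    cost : ℕ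
open State public

tick : ∀ {n} → State n → State n
tick ⟨ A , c ⟩ = ⟨ A , suc c ⟩

-- read entry (r , c): returns current value (the unit cost is charged by the caller via tick)
read : ∀ {n} → Fin n → Fin n → State n → Bool
read r c s = mat s r c

write : ∀ {n} → Fin n → Fin n → Bool → State n → State n
write r c b ⟨ A , t ⟩ =
  ⟨ (λ x y → if ⌊ x ≟ r ⌋ ∧ ⌊ y ≟ c ⌋ then b else A x y) , suc t ⟩

stepA : ∀ {n} → Fin n → Fin n → Fin n → State n → State n
stepA i j k s with ⌊ k ≟ j ⌋
... | true  = s
... | false with read i k s
...   | true  = tick s
...   | false = write j k false (tick s)

stepB : ∀ {n} → Fin n → Fin n → Fin n → State n → State n
stepB i j k s with ⌊ k ≟ i ⌋
... | true  = s
... | false with read k j s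
...   | true  = tick s
...   | false = write k i false (tick s)

kBody : ∀ {n} → Fin n → Fin n → State n → Fin n → State n
kBody i j s k = stepB i j k (stepA i j k (tick s))

jBody : ∀ {n} → Fin n → State n → Fin n → State n
jBody {n} i s j with ⌊ j ≟ i ⌋
... | true  = tick s
... | false with read i j s
...   | true  = foldl (kBody i j) (tick (tick s)) (allFin n)
...   | false = tick (tick s)

iBody : ∀ {n} → State n → Fin n → State n
iBody {n} s i = foldl (jBody i) (tick s) (allFin n)

run : ∀ {n} → Matrix n → State n
run {n} A = foldl iBody ⟨ A , 0 ⟩ (allFin n)

algorithm1 : ∀ {n} → Matrix n → Matrix n
algorithm1 A = mat (run A)

runningTime : ∀ {n} → Matrix n → ℕ
runningTime A = cost (run A)

-- Processing a pair i ≠ j with i → j deletes exactly the arcs j → k with ¬ i → k and the arcs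
-- k → i with ¬ k → j, after which the pair is closed: every successor of j is one of i and every
-- predecessor of i is one of j.  Later steps keep every processed pair that is still an arc closed,
-- so at the end every arc x → y is closed, which is transitivity; and they never delete such an
-- arc.  Hence, for a transitive B with T ⊆ B ⊆ A, B stays inside the current matrix throughout:
-- an arc j → k of B deleted while processing (i , j) would give i → j and j → k in B, so i → k
-- in B and in the matrix, although the deletion required ¬ i → k.  Counting unit costs gives
-- n (1 + n (2 + 5 n)) ≤ 8 n³ steps.

module Submission where

open import Defs
open import Data.Nat using (ℕ; zero; suc; _+_; _*_; _≤_; _<_; _^_; z≤n; s≤s)
open import Data.Nat.Properties
  using ( ≤-refl; ≤-trans; ≤-reflexive; +-comm; +-assoc; +-identityʳ; +-suc
        ; +-monoˡ-≤; +-monoʳ-≤; +-mono-≤; *-monoʳ-≤; m≤m+n; m≤m*n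
        ; n≤1+n; m<n⇒m<1+n; m<1+n⇒m<n∨m≡n; module ≤-Reasoning)
open import Data.Nat.Tactic.RingSolver using (solve-∀)
open import Data.Bool using (true; false)
open import Data.Fin using (Fin; _≟_; toℕ) renaming (zero to fzero; suc to fsuc)
open import Data.Fin.Properties using (toℕ-injective; toℕ<n)
open import Data.List using (List; []; _∷_; foldl; allFin; tabulate; length)
open import Data.List.Properties using (length-tabulate)
open import Data.Product using (Σ; _×_; _,_; proj₁; proj₂)
open import Data.Sum using (_⊎_; inj₁; inj₂)
open import Function using (_∘_)
open import Relation.Nullary using (¬_; yes; no; contradiction)
open import Relation.Binary.PropositionalEquality
  using (_≡_; _≢_; refl; sym; trans; cong; subst)
open import Relation.Binary.Core using (_⇒_)
open import Relation.Binary.Definitions using (Transitive)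

Consecutive : ∀ {n} → ℕ → ℕ → List (Fin n) → Set
Consecutive m e []       = m ≡ e
Consecutive m e (x ∷ xs) = toℕ x ≡ m × Consecutive (suc m) e xs

consecutive-tabulate : ∀ {n} len m (g : Fin len → Fin n) → (∀ q → toℕ (g q) ≡ m + toℕ q) →
                       Consecutive m (m + len) (tabulate g)
consecutive-tabulate zero      m g g≡m+ = sym (+-identityʳ m)
consecutive-tabulate (suc len) m g g≡m+ =
  trans (g≡m+ fzero) (+-identityʳ m) ,
  subst (λ e → Consecutive (suc m) e (tabulate (g ∘ fsuc))) (sym (+-suc m len))
    (consecutive-tabulate len (suc m) (g ∘ fsuc) (λ q → trans (g≡m+ (fsuc q)) (+-suc m (toℕ q))))

consecutive-allFin : ∀ n → Consecutive 0 n (allFin n)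
consecutive-allFin n = consecutive-tabulate n 0 (λ q → q) (λ _ → refl)

foldl-consecutive : ∀ {S : Set} {n e} (P : ℕ → List (Fin n) → S → Set) {f : S → Fin n → S} →
  (∀ k xs t → Consecutive (suc (toℕ k)) e xs → P (toℕ k) (k ∷ xs) t → P (suc (toℕ k)) xs (f t k)) →
  ∀ {m} xs t → Consecutive m e xs → P m xs t → P e [] (foldl f t xs)
foldl-consecutive P step []       t refl       p = p
foldl-consecutive P step (x ∷ xs) t (refl , c) p = foldl-consecutive P step xs _ c (step x xs t c p)

toℕ-<-suc-cases : ∀ {n} {x y : Fin n} → toℕ x < suc (toℕ y) → toℕ x < toℕ y ⊎ x ≡ y
toℕ-<-suc-cases x<1+y with m<1+n⇒m<n∨m≡n x<1+y
... | inj₁ x<y = inj₁ x<y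
... | inj₂ x≡y = inj₂ (toℕ-injective x≡y)

write-false-⊆ : ∀ {n} (r c : Fin n) s → Rel⟦ mat (write r c false s) ⟧ ⇒ Rel⟦ mat s ⟧
write-false-⊆ r c s {x} {y} h with x ≟ r | y ≟ c
... | yes _ | yes _ = contradiction h λ ()
... | yes _ | no _  = h
... | no _  | _     = h

write-false-keeps : ∀ {n} (r c : Fin n) s {x y} → ¬ (x ≡ r × y ≡ c) →
                    Rel⟦ mat s ⟧ x y → Rel⟦ mat (write r c false s) ⟧ x y
write-false-keeps r c s {x} {y} ¬rc h with x ≟ r | y ≟ c
... | yes x≡r | yes y≡c = contradiction (x≡r , y≡c) ¬rc
... | yes _   | no _    = h
... | no _    | _       = h

write-false-clears : ∀ {n} (r c : Fin n) s → ¬ Rel⟦ mat (write r c false s) ⟧ r c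
write-false-clears r c s h with r ≟ r | c ≟ c
... | yes _  | yes _  = contradiction h λ ()
... | yes _  | no c≢c = c≢c refl
... | no r≢r | _      = r≢r refl

stepA-⊆ : ∀ {n} (i j k : Fin n) t → Rel⟦ mat (stepA i j k t) ⟧ ⇒ Rel⟦ mat t ⟧
stepA-⊆ i j k t h with k ≟ j
... | yes _ = h
... | no _ with read i k t
...   | true  = h
...   | false = write-false-⊆ j k (tick t) h

stepA-keeps : ∀ {n} (i j k : Fin n) t {x y} → Rel⟦ mat t ⟧ x y →
              (x ≡ j → y ≡ k → k ≢ j → Rel⟦ mat t ⟧ i k) → Rel⟦ mat (stepA i j k t) ⟧ x y
stepA-keeps i j k t h i⇾k with k ≟ j
... | yes _ = h
... | no k≢j with read i k t
...   | true  = h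
...   | false = write-false-keeps j k (tick t) (λ (x≡j , y≡k) → contradiction (i⇾k x≡j y≡k k≢j) λ ()) h

stepA-clears : ∀ {n} (i j k : Fin n) t → Rel⟦ mat (stepA i j k t) ⟧ j k → k ≡ j ⊎ Rel⟦ mat t ⟧ i k
stepA-clears i j k t h with k ≟ j
... | yes k≡j = inj₁ k≡j
... | no _ with read i k t
...   | true  = inj₂ refl
...   | false = contradiction h (write-false-clears j k (tick t))

stepB-⊆ : ∀ {n} (i j k : Fin n) t → Rel⟦ mat (stepB i j k t) ⟧ ⇒ Rel⟦ mat t ⟧
stepB-⊆ i j k t h with k ≟ i
... | yes _ = h
... | no _ with read k j t
...   | true  = h
...   | false = write-false-⊆ k i (tick t) h

stepB-keeps : ∀ {n} (i j k : Fin n) t {x y} → Rel⟦ mat t ⟧ x y →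
              (x ≡ k → y ≡ i → k ≢ i → Rel⟦ mat t ⟧ k j) → Rel⟦ mat (stepB i j k t) ⟧ x y
stepB-keeps i j k t h k⇾j with k ≟ i
... | yes _ = h
... | no k≢i with read k j t
...   | true  = h
...   | false = write-false-keeps k i (tick t) (λ (x≡k , y≡i) → contradiction (k⇾j x≡k y≡i k≢i) λ ()) h

stepB-clears : ∀ {n} (i j k : Fin n) t → Rel⟦ mat (stepB i j k t) ⟧ k i → k ≡ i ⊎ Rel⟦ mat t ⟧ k j
stepB-clears i j k t h with k ≟ i
... | yes k≡i = inj₁ k≡i
... | no _ with read k j t
...   | true  = inj₂ refl
...   | false = contradiction h (write-false-clears k i (tick t))

-- The effect of the k-loop for i ≠ j with i → j: since it writes neither row i nor column j,
-- every test reads the matrix as it was before the loop.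
record ClosesPair {n} (i j : Fin n) (M M′ : Matrix n) : Set where
  field
    shrinks   : Rel⟦ M′ ⟧ ⇒ Rel⟦ M ⟧
    keeps     : ∀ {x y} → Rel⟦ M ⟧ x y → (x ≡ j → Rel⟦ M ⟧ i y) → (y ≡ i → Rel⟦ M ⟧ x j) →
                Rel⟦ M′ ⟧ x y
    row-bound : ∀ {y} → Rel⟦ M′ ⟧ j y → Rel⟦ M ⟧ i y
    col-bound : ∀ {x} → Rel⟦ M′ ⟧ x i → Rel⟦ M ⟧ x j

module KLoop {n} (i j : Fin n) (s : State n) (i≢j : i ≢ j) (i⇾j : Rel⟦ mat s ⟧ i j) where

  record ClosesPairUpTo (m : ℕ) (M′ : Matrix n) : Set where
    field
      shrinks   : Rel⟦ M′ ⟧ ⇒ Rel⟦ mat s ⟧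
      keeps     : ∀ {x y} → Rel⟦ mat s ⟧ x y → (x ≡ j → Rel⟦ mat s ⟧ i y) →
                  (y ≡ i → Rel⟦ mat s ⟧ x j) → Rel⟦ M′ ⟧ x y
      row-bound : ∀ {y} → toℕ y < m → Rel⟦ M′ ⟧ j y → Rel⟦ mat s ⟧ i y
      col-bound : ∀ {x} → toℕ x < m → Rel⟦ M′ ⟧ x i → Rel⟦ mat s ⟧ x j

  kBody-step : ∀ k t → ClosesPairUpTo (toℕ k) (mat t) → ClosesPairUpTo (suc (toℕ k)) (mat (kBody i j t k))
  kBody-step k t P = record
    { shrinks   = P.shrinks ∘ shrinks′
    ; keeps     = keeps′
    ; row-bound = row-bound′
    ; col-bound = col-bound′
    }
    where
      module P = ClosesPairUpTo P
      u = stepA i j k (tick t)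

      shrinks′ : Rel⟦ mat (kBody i j t k) ⟧ ⇒ Rel⟦ mat t ⟧
      shrinks′ = stepA-⊆ i j k (tick t) ∘ stepB-⊆ i j k u

      keeps′ : ∀ {x y} → Rel⟦ mat s ⟧ x y → (x ≡ j → Rel⟦ mat s ⟧ i y) →
               (y ≡ i → Rel⟦ mat s ⟧ x j) → Rel⟦ mat (kBody i j t k) ⟧ x y
      keeps′ h via-j via-i = stepB-keeps i j k u
        (stepA-keeps i j k (tick t) (P.keeps h via-j via-i)
          λ { refl refl _ → P.keeps (via-j refl) (λ i≡j → contradiction i≡j i≢j) λ { refl → i⇾j } })
        λ { refl refl _ → stepA-keeps i j k (tick t)
              (P.keeps (via-i refl) (λ { refl → i⇾j }) (λ j≡i → contradiction (sym j≡i) i≢j))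
              λ { refl _ j≢j → contradiction refl j≢j } }

      row-bound′ : ∀ {y} → toℕ y < suc (toℕ k) → Rel⟦ mat (kBody i j t k) ⟧ j y → Rel⟦ mat s ⟧ i y
      row-bound′ y<1+k h with toℕ-<-suc-cases y<1+k
      ... | inj₁ y<k = P.row-bound y<k (shrinks′ h)
      ... | inj₂ refl with stepA-clears i j k (tick t) (stepB-⊆ i j k u h)
      ...   | inj₁ refl = i⇾j
      ...   | inj₂ i⇾k  = P.shrinks i⇾k

      col-bound′ : ∀ {x} → toℕ x < suc (toℕ k) → Rel⟦ mat (kBody i j t k) ⟧ x i → Rel⟦ mat s ⟧ x j
      col-bound′ x<1+k h with toℕ-<-suc-cases x<1+k
      ... | inj₁ x<k = P.col-bound x<k (shrinks′ h)
      ... | inj₂ refl with stepB-clears i j k u h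
      ...   | inj₁ refl = i⇾j
      ...   | inj₂ k⇾j  = P.shrinks (stepA-⊆ i j k (tick t) k⇾j)

  closesPair : ClosesPair i j (mat s) (mat (foldl (kBody i j) (tick (tick s)) (allFin n)))
  closesPair = record
    { shrinks   = P.shrinks
    ; keeps     = P.keeps
    ; row-bound = λ {y} → P.row-bound (toℕ<n y)
    ; col-bound = λ {x} → P.col-bound (toℕ<n x)
    }
    where
      P : ClosesPairUpTo n (mat (foldl (kBody i j) (tick (tick s)) (allFin n)))
      P = foldl-consecutive (λ m _ t → ClosesPairUpTo m (mat t)) (λ k _ t _ → kBody-step k t)
            (allFin n) _ (consecutive-allFin n)
            record { shrinks = λ h → h ; keeps = λ h _ _ → h ; row-bound = λ () ; col-bound = λ () }
      module P = ClosesPairUpTo P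

data PairStep {n} (i j : Fin n) (M M′ : Matrix n) : Set where
  skipped : M′ ≡ M → ¬ (i ≢ j × Rel⟦ M ⟧ i j) → PairStep i j M M′
  closed  : i ≢ j → Rel⟦ M ⟧ i j → ClosesPair i j M M′ → PairStep i j M M′

jBody-pairStep : ∀ {n} (i : Fin n) s j → PairStep i j (mat s) (mat (jBody i s j))
jBody-pairStep i s j with j ≟ i
... | yes refl = skipped refl λ (i≢i , _) → i≢i refl
... | no j≢i with read i j s in i⇾j
...   | true  = closed (j≢i ∘ sym) i⇾j (KLoop.closesPair i j s (j≢i ∘ sym) i⇾j)
...   | false = skipped refl λ (_ , i⇾j′) → contradiction (trans (sym i⇾j) i⇾j′) λ ()

record Closed {n} (M : Matrix n) (x y : Fin n) : Set where
  field
    row : ∀ {k} → Rel⟦ M ⟧ y k → Rel⟦ M ⟧ x k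
    col : ∀ {k} → Rel⟦ M ⟧ k x → Rel⟦ M ⟧ k y

Processed : ∀ {n} → ℕ → ℕ → Fin n → Fin n → Set
Processed a m x y = toℕ x < a ⊎ (toℕ x ≡ a × toℕ y < m)

ClosedBefore : ∀ {n} → ℕ → ℕ → Matrix n → Set
ClosedBefore a m M = ∀ {x y} → x ≢ y → Processed a m x y → Rel⟦ M ⟧ x y → Closed M x y

nothing-processed : ∀ {n} {M : Matrix n} → ClosedBefore 0 0 M
nothing-processed _ (inj₁ ())
nothing-processed _ (inj₂ (_ , ()))

closedBefore-end⇒transitive : ∀ {n} {M : Matrix n} → ClosedBefore n 0 M → Transitive Rel⟦ M ⟧
closedBefore-end⇒transitive cb {x} {y} x⇾y y⇾z with x ≟ y
... | yes refl = y⇾z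
... | no x≢y   = Closed.row (cb x≢y (inj₁ (toℕ<n x)) x⇾y) y⇾z

module _ {n} {x y : Fin n} where

  processed-next : ∀ {a m} → Processed a m x y → Processed a (suc m) x y
  processed-next (inj₁ x<a)         = inj₁ x<a
  processed-next (inj₂ (x≡a , y<m)) = inj₂ (x≡a , m<n⇒m<1+n y<m)

  processed-row-end : ∀ {a} → Processed (suc a) 0 x y → Processed a n x y
  processed-row-end (inj₁ x<1+a) with m<1+n⇒m<n∨m≡n x<1+a
  ... | inj₁ x<a = inj₁ x<a
  ... | inj₂ x≡a = inj₂ (x≡a , toℕ<n y)

  processed-next-row : ∀ {a} → Processed a n x y → Processed (suc a) 0 x y
  processed-next-row (inj₁ x<a)       = inj₁ (m<n⇒m<1+n x<a)
  processed-next-row (inj₂ (refl , _)) = inj₁ ≤-refl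

  processed-suc-cases : ∀ {i j : Fin n} → Processed (toℕ i) (suc (toℕ j)) x y →
                        Processed (toℕ i) (toℕ j) x y ⊎ (x ≡ i × y ≡ j)
  processed-suc-cases (inj₁ x<i) = inj₁ (inj₁ x<i)
  processed-suc-cases (inj₂ (x≡i , y<1+j)) with toℕ-<-suc-cases y<1+j
  ... | inj₁ y<j  = inj₁ (inj₂ (x≡i , y<j))
  ... | inj₂ y≡j = inj₂ (toℕ-injective x≡i , y≡j)

  processed-earlier-row : ∀ {i : Fin n} {m} → Processed (toℕ i) m x y → x ≢ i → toℕ x < toℕ i
  processed-earlier-row (inj₁ x<i)       x≢i = x<i
  processed-earlier-row (inj₂ (x≡i , _)) x≢i = contradiction (toℕ-injective x≡i) x≢i

closedBefore-next-row : ∀ {n a} {M : Matrix n} → ClosedBefore a n M → ClosedBefore (suc a) 0 M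
closedBefore-next-row cb x≢y = cb x≢y ∘ processed-row-end

module _ {n} {i j : Fin n} {M M′ : Matrix n} where

  pairStep-⊆ : PairStep i j M M′ → Rel⟦ M′ ⟧ ⇒ Rel⟦ M ⟧
  pairStep-⊆ (skipped refl _) h = h
  pairStep-⊆ (closed _ _ C)   h = ClosesPair.shrinks C h

  pairStep-keeps-pair : PairStep i j M M′ → i ≢ j → Rel⟦ M ⟧ i j → Rel⟦ M′ ⟧ i j
  pairStep-keeps-pair (skipped refl _) _ h = h
  pairStep-keeps-pair (closed i≢j _ C) _ h =
    ClosesPair.keeps C h (λ i≡j → contradiction i≡j i≢j) (λ j≡i → contradiction (sym j≡i) i≢j)

  pairStep-closes : PairStep i j M M′ → i ≢ j → Rel⟦ M′ ⟧ i j → Closed M′ i j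
  pairStep-closes (skipped refl ¬i⇾j) i≢j h = contradiction (i≢j , h) ¬i⇾j
  pairStep-closes (closed _ i⇾j C)    i≢j _ = record
    { row = λ h → keeps (row-bound h) (λ i≡j → contradiction i≡j i≢j) λ { refl → i⇾j }
    ; col = λ h → keeps (col-bound h) (λ { refl → i⇾j }) (λ j≡i → contradiction (sym j≡i) i≢j)
    }
    where open ClosesPair C

  -- Closedness of (x , y) supplies the arc i → y needed if x = j, and x → j needed if y = i.
  pairStep-keeps-processed : ClosedBefore (toℕ i) (toℕ j) M → PairStep i j M M′ →
    ∀ {x y} → x ≢ y → Processed (toℕ i) (toℕ j) x y → Rel⟦ M ⟧ x y → Rel⟦ M′ ⟧ x y
  pairStep-keeps-processed cb (skipped refl _)   x≢y p h = h
  pairStep-keeps-processed cb (closed _ i⇾j C) x≢y p h =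
    ClosesPair.keeps C h (λ { refl → Closed.col (cb x≢y p h) i⇾j })
                         (λ { refl → Closed.row (cb x≢y p h) i⇾j })

  pairStep-⊇ : ∀ {B : Matrix n} → Transitive Rel⟦ B ⟧ → Rel⟦ B ⟧ ⇒ Rel⟦ M ⟧ →
               (i ≢ j → Rel⟦ M ⟧ i j → Rel⟦ B ⟧ i j) → PairStep i j M M′ → Rel⟦ B ⟧ ⇒ Rel⟦ M′ ⟧
  pairStep-⊇ trB B⊆M ij∈B (skipped refl _)     h = B⊆M h
  pairStep-⊇ trB B⊆M ij∈B (closed i≢j i⇾j C) h =
    ClosesPair.keeps C (B⊆M h) (λ { refl → B⊆M (trB (ij∈B i≢j i⇾j) h) })
                               (λ { refl → B⊆M (trB h (ij∈B i≢j i⇾j)) })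

closedBefore-earlier-trans : ∀ {n a m} {M : Matrix n} {x y z} → ClosedBefore a m M → toℕ y < a →
                             Rel⟦ M ⟧ x y → Rel⟦ M ⟧ y z → Rel⟦ M ⟧ x z
closedBefore-earlier-trans {y = y} {z} cb y<a x⇾y y⇾z with y ≟ z
... | yes refl = x⇾y
... | no y≢z   = Closed.col (cb y≢z (inj₁ y<a) y⇾z) x⇾y

module _ {n} {i j : Fin n} {M M′ : Matrix n} (cb : ClosedBefore (toℕ i) (toℕ j) M) where

  closesPair-preserves-closed : i ≢ j → Rel⟦ M ⟧ i j → ClosesPair i j M M′ →
    ∀ {x y} → x ≢ y → Processed (toℕ i) (toℕ j) x y → Rel⟦ M′ ⟧ x y → Closed M′ x y
  closesPair-preserves-closed i≢j i⇾j C x≢y p h = record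
    { row = λ y⇾k → keeps (old.row (shrinks y⇾k))
              (λ { refl → closedBefore-earlier-trans cb (processed-earlier-row p (i≢j ∘ sym))
                            i⇾j (old.row (shrinks y⇾k)) })
              (λ { refl → old.row (col-bound y⇾k) })
    ; col = λ k⇾x → keeps (old.col (shrinks k⇾x))
              (λ { refl → old.col (row-bound k⇾x) })
              (λ { refl → closedBefore-earlier-trans cb (processed-earlier-row p x≢y)
                            (shrinks k⇾x) (old.row i⇾j) })
    }
    where
      open ClosesPair C
      module old = Closed (cb x≢y p (shrinks h))

  closedBefore-step : PairStep i j M M′ → ClosedBefore (toℕ i) (suc (toℕ j)) M′
  closedBefore-step ps x≢y p h with processed-suc-cases p | ps
  ... | inj₂ (refl , refl) | _                = pairStep-closes ps x≢y h
  ... | inj₁ p′           | skipped refl _   = cb x≢y p′ h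
  ... | inj₁ p′           | closed i≢j i⇾j C = closesPair-preserves-closed i≢j i⇾j C x≢y p′ h

-- Invariants may mention the iterations still to run, so that they can refer to the final output.
module NestedLoops {n : ℕ}
  (Outer : ℕ → List (Fin n) → State n → Set)
  (Inner : Fin n → ℕ → List (Fin n) → List (Fin n) → State n → Set)
  (enter : ∀ {i rest t} → Outer (toℕ i) (i ∷ rest) t → Inner i 0 (allFin n) rest (tick t))
  (step  : ∀ {i rest j js t} → Consecutive (suc (toℕ i)) n rest → Consecutive (suc (toℕ j)) n js →
           Inner i (toℕ j) (j ∷ js) rest t → Inner i (suc (toℕ j)) js rest (jBody i t j))
  (exit  : ∀ {i rest t} → Inner i n [] rest t → Outer (suc (toℕ i)) rest t)
  where

  inner : ∀ {i rest m} js t → Consecutive (suc (toℕ i)) n rest → Consecutive m n js →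
          Inner i m js rest t → Inner i n [] rest (foldl (jBody i) t js)
  inner {i} {rest} js t rest-ok =
    foldl-consecutive (λ m js′ → Inner i m js′ rest) (λ _ _ _ → step rest-ok) js t

  outer : ∀ {k} xs t → Consecutive k n xs → Outer k xs t → Outer n [] (foldl iBody t xs)
  outer = foldl-consecutive Outer λ i rest t rest-ok →
    exit ∘ inner (allFin n) (tick t) rest-ok (consecutive-allFin n) ∘ enter

  finish : ∀ {i rest m} js t → Consecutive (suc (toℕ i)) n rest → Consecutive m n js →
           Inner i m js rest t → Outer n [] (foldl iBody (foldl (jBody i) t js) rest)
  finish js t rest-ok js-ok = outer _ _ rest-ok ∘ exit ∘ inner js t rest-ok js-ok

algorithm1-closed-⊆ : ∀ {n} (A : Matrix n) →
                      ClosedBefore n 0 (algorithm1 A) × (Rel⟦ algorithm1 A ⟧ ⇒ Rel⟦ A ⟧)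
algorithm1-closed-⊆ {n} A =
  outer (allFin n) ⟨ A , 0 ⟩ (consecutive-allFin n) (nothing-processed , λ h → h)
  where
    Correct : ℕ → ℕ → State n → Set
    Correct a m t = ClosedBefore a m (mat t) × (Rel⟦ mat t ⟧ ⇒ Rel⟦ A ⟧)

    step : ∀ {i j} t → Correct (toℕ i) (toℕ j) t → Correct (toℕ i) (suc (toℕ j)) (jBody i t j)
    step {i} {j} t (cb , t⊆A) = closedBefore-step cb ps , t⊆A ∘ pairStep-⊆ ps
      where ps = jBody-pairStep i t j

    open NestedLoops (λ a _ → Correct a 0) (λ i m _ _ → Correct (toℕ i) m) (λ inv → inv)
      (λ _ _ → step _) (λ (cb , t⊆A) → closedBefore-next-row cb , t⊆A)

processed-arc-survives : ∀ {n} {x y : Fin n} → x ≢ y → ∀ {i rest m} js t →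
  Consecutive (suc (toℕ i)) n rest → Consecutive m n js →
  ClosedBefore (toℕ i) m (mat t) → Processed (toℕ i) m x y → Rel⟦ mat t ⟧ x y →
  Rel⟦ mat (foldl iBody (foldl (jBody i) t js) rest) ⟧ x y
processed-arc-survives {n} {x} {y} x≢y js t rest-ok js-ok cb p h =
  proj₂ (proj₂ (finish js t rest-ok js-ok (cb , p , h)))
  where
    Survives : ℕ → ℕ → State n → Set
    Survives a m t = ClosedBefore a m (mat t) × Processed a m x y × Rel⟦ mat t ⟧ x y

    step : ∀ {i j} t → Survives (toℕ i) (toℕ j) t → Survives (toℕ i) (suc (toℕ j)) (jBody i t j)
    step {i} {j} t (cb , p , h) =
      closedBefore-step cb ps , processed-next p , pairStep-keeps-processed cb ps x≢y p h
      where ps = jBody-pairStep i t j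

    open NestedLoops (λ a _ → Survives a 0) (λ i m _ _ → Survives (toℕ i) m) (λ inv → inv)
      (λ _ _ → step _) (λ (cb , p , h) → closedBefore-next-row cb , processed-next-row p , h)

module _ {n} (A B : Matrix n) (trB : Transitive Rel⟦ B ⟧) (T⊆B : Rel⟦ algorithm1 A ⟧ ⇒ Rel⟦ B ⟧) where

  algorithm1-maximal : Rel⟦ B ⟧ ⇒ Rel⟦ A ⟧ → Rel⟦ B ⟧ ⇒ Rel⟦ algorithm1 A ⟧
  algorithm1-maximal B⊆A =
    proj₂ (proj₂ (outer (allFin n) ⟨ A , 0 ⟩ (consecutive-allFin n) (nothing-processed , refl , B⊆A)))
    where
      Outer : ℕ → List (Fin n) → State n → Set
      Outer a xs t = ClosedBefore a 0 (mat t) × (run A ≡ foldl iBody t xs) × (Rel⟦ B ⟧ ⇒ Rel⟦ mat t ⟧)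

      Inner : Fin n → ℕ → List (Fin n) → List (Fin n) → State n → Set
      Inner i m js rest t = ClosedBefore (toℕ i) m (mat t)
                          × (run A ≡ foldl iBody (foldl (jBody i) t js) rest)
                          × (Rel⟦ B ⟧ ⇒ Rel⟦ mat t ⟧)

      step : ∀ {i rest j js t} → Consecutive (suc (toℕ i)) n rest → Consecutive (suc (toℕ j)) n js →
             Inner i (toℕ j) (j ∷ js) rest t → Inner i (suc (toℕ j)) js rest (jBody i t j)
      step {i} {rest} {j} {js} {t} rest-ok js-ok (cb , resumes , B⊆t) =
        closedBefore-step cb ps , resumes , pairStep-⊇ trB B⊆t ij∈B ps
        where
          ps = jBody-pairStep i t j
          -- the arc i → j survives to the output, which lies inside B
          ij∈B : i ≢ j → Rel⟦ mat t ⟧ i j → Rel⟦ B ⟧ i j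
          ij∈B i≢j h = T⊆B (subst (λ u → Rel⟦ mat u ⟧ i j) (sym resumes)
            (processed-arc-survives i≢j js (jBody i t j) rest-ok js-ok
              (closedBefore-step cb ps) (inj₂ (refl , ≤-refl)) (pairStep-keeps-pair ps i≢j h)))

      open NestedLoops Outer Inner (λ inv → inv) step
        (λ (cb , resumes , B⊆t) → closedBefore-next-row cb , resumes , B⊆t)

foldl-cost : ∀ {n} {X : Set} (f : State n → X → State n) {d} → (∀ t x → cost (f t x) ≤ cost t + d) →
             ∀ xs t → cost (foldl f t xs) ≤ cost t + length xs * d
foldl-cost f     bound []       t = ≤-reflexive (sym (+-identityʳ (cost t)))
foldl-cost f {d} bound (x ∷ xs) t = begin
  cost (foldl f (f t x) xs)     ≤⟨ foldl-cost f bound xs (f t x) ⟩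
  cost (f t x) + length xs * d  ≤⟨ +-monoˡ-≤ _ (bound t x) ⟩
  cost t + d + length xs * d    ≡⟨ +-assoc (cost t) d _ ⟩
  cost t + (d + length xs * d)  ∎
  where open ≤-Reasoning

length-allFin : ∀ n → length (allFin n) ≡ n
length-allFin n = length-tabulate (λ q → q)

1+n≤n+2 : ∀ n → suc n ≤ n + 2
1+n≤n+2 n = ≤-trans (n≤1+n (suc n)) (≤-reflexive (+-comm 2 n))

stepA-cost : ∀ {n} (i j k : Fin n) t → cost (stepA i j k t) ≤ cost t + 2
stepA-cost i j k t with k ≟ j
... | yes _ = m≤m+n _ 2
... | no _ with read i k t
...   | true  = 1+n≤n+2 (cost t)
...   | false = ≤-reflexive (+-comm 2 (cost t))

stepB-cost : ∀ {n} (i j k : Fin n) t → cost (stepB i j k t) ≤ cost t + 2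
stepB-cost i j k t with k ≟ i
... | yes _ = m≤m+n _ 2
... | no _ with read k j t
...   | true  = 1+n≤n+2 (cost t)
...   | false = ≤-reflexive (+-comm 2 (cost t))

kBody-cost : ∀ {n} (i j : Fin n) t k → cost (kBody i j t k) ≤ cost t + 5
kBody-cost i j t k = begin
  cost (stepB i j k (stepA i j k (tick t)))  ≤⟨ stepB-cost i j k _ ⟩
  cost (stepA i j k (tick t)) + 2            ≤⟨ +-monoˡ-≤ 2 (stepA-cost i j k (tick t)) ⟩
  suc (cost t) + 2 + 2                       ≡⟨ reassociate (cost t) ⟩
  cost t + 5                                 ∎
  where
    open ≤-Reasoning
    reassociate : ∀ c → suc c + 2 + 2 ≡ c + 5
    reassociate = solve-∀

jBody-cost : ∀ {n} (i : Fin n) t j → cost (jBody i t j) ≤ cost t + (2 + n * 5)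
jBody-cost {n} i t j with j ≟ i
... | yes _ = ≤-trans (1+n≤n+2 (cost t)) (+-monoʳ-≤ (cost t) (m≤m+n 2 (n * 5)))
... | no _ with read i j t
...   | false = ≤-trans (≤-reflexive (+-comm 2 (cost t))) (+-monoʳ-≤ (cost t) (m≤m+n 2 (n * 5)))
...   | true  = begin
  cost (foldl (kBody i j) (tick (tick t)) (allFin n))  ≤⟨ foldl-cost (kBody i j) (kBody-cost i j) (allFin n) _ ⟩
  2 + cost t + length (allFin n) * 5                   ≡⟨ cong (λ l → 2 + cost t + l * 5) (length-allFin n) ⟩
  2 + cost t + n * 5                                   ≡⟨ reassociate (cost t) (n * 5) ⟩
  cost t + (2 + n * 5)                                 ∎
  where
    open ≤-Reasoning
    reassociate : ∀ c m → 2 + c + m ≡ c + (2 + m)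
    reassociate = solve-∀

iBody-cost : ∀ {n} t i → cost (iBody {n} t i) ≤ cost t + (1 + n * (2 + n * 5))
iBody-cost {n} t i = begin
  cost (foldl (jBody i) (tick t) (allFin n))       ≤⟨ foldl-cost (jBody i) (jBody-cost i) (allFin n) _ ⟩
  1 + cost t + length (allFin n) * (2 + n * 5)    ≡⟨ cong (λ l → 1 + cost t + l * (2 + n * 5)) (length-allFin n) ⟩
  1 + cost t + n * (2 + n * 5)                    ≡⟨ reassociate (cost t) (n * (2 + n * 5)) ⟩
  cost t + (1 + n * (2 + n * 5))                  ∎
  where
    open ≤-Reasoning
    reassociate : ∀ c m → 1 + c + m ≡ c + (1 + m)
    reassociate = solve-∀

runningTime-≤ : ∀ {n} (A : Matrix n) → runningTime A ≤ n * (1 + n * (2 + n * 5))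
runningTime-≤ {n} A = begin
  cost (foldl iBody ⟨ A , 0 ⟩ (allFin n))     ≤⟨ foldl-cost iBody iBody-cost (allFin n) _ ⟩
  length (allFin n) * (1 + n * (2 + n * 5))  ≡⟨ cong (_* (1 + n * (2 + n * 5))) (length-allFin n) ⟩
  n * (1 + n * (2 + n * 5))                  ∎
  where open ≤-Reasoning

cubic-≤ : ∀ n → n * (1 + n * (2 + n * 5)) ≤ 8 * n ^ 3
cubic-≤ zero       = z≤n
cubic-≤ n@(suc _) = begin
  n * (1 + n * (2 + n * 5))                         ≡⟨ expand n ⟩
  n * 1 + (2 * (n * n) + 5 * (n * (n * n)))         ≤⟨ +-mono-≤ (*-monoʳ-≤ n 1≤n*n)
                                                        (+-monoˡ-≤ _ (*-monoʳ-≤ 2 (*-monoʳ-≤ n (m≤m*n n n)))) ⟩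
  n * (n * n) + (2 * (n * (n * n)) + 5 * (n * (n * n))) ≡⟨ collect n ⟩
  8 * n ^ 3                                         ∎
  where
    open ≤-Reasoning
    1≤n*n : 1 ≤ n * n
    1≤n*n = s≤s z≤n
    expand : ∀ n → n * (1 + n * (2 + n * 5)) ≡ n * 1 + (2 * (n * n) + 5 * (n * (n * n)))
    expand = solve-∀
    collect : ∀ n → n * (n * n) + (2 * (n * (n * n)) + 5 * (n * (n * n))) ≡ 8 * (n * (n * (n * 1)))
    collect = solve-∀

theorem5 : Σ ℕ (λ c → ∀ (n : ℕ) (A : Matrix n) → runningTime A ≤ c * n ^ 3)
    × (∀ (n : ℕ) (A : Matrix n) →
         Transitive Rel⟦ algorithm1 A ⟧
       × (Rel⟦ algorithm1 A ⟧ ⇒ Rel⟦ A ⟧)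
       × (∀ (B : Matrix n) → Transitive Rel⟦ B ⟧
            → Rel⟦ algorithm1 A ⟧ ⇒ Rel⟦ B ⟧
            → Rel⟦ B ⟧ ⇒ Rel⟦ A ⟧
            → Rel⟦ B ⟧ ⇒ Rel⟦ algorithm1 A ⟧))
theorem5 = (8 , λ n A → ≤-trans (runningTime-≤ A) (cubic-≤ n))
         , λ n A → closedBefore-end⇒transitive (proj₁ (algorithm1-closed-⊆ A))
                 , proj₂ (algorithm1-closed-⊆ A)
                 , algorithm1-maximal A
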